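{- For every graph $G$ and every independent set $I$ in $G$, $\mu_\alpha(G-N[I])\leq \mu_\alpha(G)$.
   Context: All graphs are finite and simple; the null graph is allowed, with $\alpha=i=0$. For a graph $G$, $\alpha(G)$ is the maximum size of an independent set, $i(G)$ is the minimum size of an inclusion-maximal independent set, and $\mu_\alpha(G)=\alpha(G)-i(G)$. $N[I]$ denotes the closed neighborhood $I\cup\bigcup_{v\in I}N(v)$. -}

module Defs where

open import Data.Bool using (Bool; true; false; _∧_; _∨_; not; T)
open import Data.Nat using (ℕ; zero; suc; _⊔_; _⊓_; _∸_)
open import Data.Fin using (Fin)
open import Data.Vec using (Vec; []; _∷_; lookup; tabulate)
open import Data.List using (List; []; _∷_; map; _++_; filter; foldr; allFin)
open import Data.Bool.ListAction using (any; all)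
open import Data.Bool using (_≟_)
open import Relation.Binary.PropositionalEquality using (_≡_)
open import Relation.Nullary.Decidable using (yes; no)

record Graph (n : ℕ) : Set where
  field
    adj    : Fin n → Fin n → Bool
    sym    : ∀ u v → adj u v ≡ adj v u
    irrefl : ∀ v → adj v v ≡ false
open Graph public

VSet : ℕ → Set
VSet n = Vec Bool n

_∈ᵇ_ : ∀ {n} → Fin n → VSet n → Bool
v ∈ᵇ S = lookup S v

size : ∀ {n} → VSet n → ℕ
size [] = 0
size (true ∷ S) = suc (size S)
size (false ∷ S) = size S

full : ∀ {n} → VSet n
full = tabulate (λ _ → true)

complement : ∀ {n} → VSet n → VSet n
complement S = tabulate (λ v → not (v ∈ᵇ S))

anyᵇ : ∀ {n} → (Fin n → Bool) → Bool
anyᵇ p = any p (allFin _)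

allᵇ : ∀ {n} → (Fin n → Bool) → Bool
allᵇ p = all p (allFin _)

subsets : ∀ n → List (VSet n)
subsets zero = [] ∷ []
subsets (suc n) = map (true ∷_) (subsets n) ++ map (false ∷_) (subsets n)

subsetᵇ : ∀ {n} → VSet n → VSet n → Bool
subsetᵇ T S = allᵇ (λ v → not (v ∈ᵇ T) ∨ (v ∈ᵇ S))

independentᵇ : ∀ {n} → Graph n → VSet n → Bool
independentᵇ G T = allᵇ (λ u → allᵇ (λ v → not ((u ∈ᵇ T) ∧ (v ∈ᵇ T) ∧ adj G u v)))

-- The induced subgraph G[S] is represented by the vertex set S ⊆ V(G).
-- T is an independent set of G[S]:
indepInᵇ : ∀ {n} → Graph n → VSet n → VSet n → Bool
indepInᵇ G S T = subsetᵇ T S ∧ independentᵇ G T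

maximalIndepInᵇ : ∀ {n} → Graph n → VSet n → VSet n → Bool
maximalIndepInᵇ G S T =
  indepInᵇ G S T ∧
  allᵇ (λ v → not ((v ∈ᵇ S) ∧ not (v ∈ᵇ T)) ∨ anyᵇ (λ u → (u ∈ᵇ T) ∧ adj G u v))

αIn : ∀ {n} → Graph n → VSet n → ℕ
αIn {n} G S = foldr _⊔_ 0 (map size (filter (λ T → indepInᵇ G S T ≟ true) (subsets n)))

-- i(G[S]) : minimum size of a maximal independent set of G[S]
-- (the list is never empty; the default n is an upper bound of every size)
iIn : ∀ {n} → Graph n → VSet n → ℕ
iIn {n} G S = foldr _⊓_ n (map size (filter (λ T → maximalIndepInᵇ G S T ≟ true) (subsets n)))

μαIn : ∀ {n} → Graph n → VSet n → ℕ
μαIn G S = αIn G S ∸ iIn G S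

μα : ∀ {n} → Graph n → ℕ
μα G = μαIn G full

closedNbhd : ∀ {n} → Graph n → VSet n → VSet n
closedNbhd G I = tabulate (λ v → (v ∈ᵇ I) ∨ anyᵇ (λ u → (u ∈ᵇ I) ∧ adj G u v))

μαMinusClosedNbhd : ∀ {n} → Graph n → VSet n → ℕ
μαMinusClosedNbhd G I = μαIn G (complement (closedNbhd G I))

IsIndependent : ∀ {n} → Graph n → VSet n → Set
IsIndependent G I = independentᵇ G I ≡ true

-- Let S = V ∖ N[I]. No vertex of S lies in or next to I, so I ∪ J is independent in G for every
-- independent J of G[S], and I ∪ K is maximal independent in G for every maximal independent K of
-- G[S] (a vertex outside I ∪ K is either in N[I], hence dominated by I, or in S, hence dominated by K).
-- Hence α(G - N[I]) + |I| ≤ α(G) and i(G) ≤ i(G - N[I]) + |I|, and subtracting gives the claim.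
module Submission where

open import Defs
open import Data.Nat using (ℕ; _≤_; suc; _+_; _∸_; _⊔_; _⊓_; z≤n)
open import Data.Nat.Properties
  using ( ≤-refl; ≤-trans; +-comm; +-suc; +-monoʳ-≤; ∸-monoˡ-≤; ∸-monoʳ-≤; ∸-+-assoc; m∸n≤m; m≤n+m∸n
        ; m≤n+o⇒m∸n≤o; m+n≤o⇒m≤o∸n; ⊔-lub; ⊓-glb; m⊓n≤n; m⊔n≤o⇒m≤o; m⊔n≤o⇒n≤o; m≤n⊓o⇒m≤n; m≤n⊓o⇒m≤o
        ; module ≤-Reasoning )
open import Data.Bool using (Bool; true; false; _∧_; _∨_; not; T; T?; _≟_)
open import Data.Bool.Properties using (T-≡; T-∧; T-∨)
open import Data.Empty using (⊥-elim)
open import Data.Unit using (tt)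
open import Data.Fin using (Fin; zero; suc)
open import Data.Fin.Subset using (_∪_)
open import Data.Vec using ([]; _∷_)
open import Data.Vec.Properties using (lookup-zipWith; lookup∘tabulate)
open import Data.List using (List; map; filter; foldr; allFin)
open import Data.List.Properties using (foldr-forcesᵇ; foldr-preservesᵇ; foldr-preservesʳ)
open import Data.List.Membership.Propositional using (_∈_; lose)
open import Data.List.Membership.Propositional.Properties
  using (∈-filter⁺; ∈-filter⁻; ∈-map⁺; ∈-++⁺ˡ; ∈-++⁺ʳ; ∈-allFin)
open import Data.List.Relation.Unary.All as All using (All)
open import Data.List.Relation.Unary.All.Properties using (all⁺; all⁻; map⁺)
open import Data.List.Relation.Unary.Any using (here; satisfied)
open import Data.List.Relation.Unary.Any.Properties using (any⁺; any⁻)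
open import Data.Product as Product using (∃; _×_; _,_; proj₂)
open import Data.Sum as Sum using (_⊎_; inj₁; inj₂)
open import Function using (_∘_)
open import Function.Bundles using (_⇔_; mk⇔; module Equivalence)
open import Relation.Binary.PropositionalEquality using (_≡_; refl; cong; subst)
import Relation.Binary.PropositionalEquality as ≡
open import Relation.Nullary using (¬_; yes; no)

open Equivalence using (to; from)
open ≤-Reasoning

private
  variable
    n : ℕ

foldr-⊔-upperBounds : (xs : List ℕ) → All (_≤ foldr _⊔_ 0 xs) xs
foldr-⊔-upperBounds xs =
  foldr-forcesᵇ (λ m k le → m⊔n≤o⇒m≤o m k le , m⊔n≤o⇒n≤o m k le) 0 xs ≤-refl

foldr-⊔-lub : ∀ {b} {xs : List ℕ} → All (_≤ b) xs → foldr _⊔_ 0 xs ≤ b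
foldr-⊔-lub = foldr-preservesᵇ ⊔-lub z≤n

foldr-⊓-lowerBounds : ∀ d (xs : List ℕ) → All (foldr _⊓_ d xs ≤_) xs
foldr-⊓-lowerBounds d xs =
  foldr-forcesᵇ (λ m k le → m≤n⊓o⇒m≤n m k le , m≤n⊓o⇒m≤o m k le) d xs ≤-refl

foldr-⊓≤init : ∀ d (xs : List ℕ) → foldr _⊓_ d xs ≤ d
foldr-⊓≤init d = foldr-preservesʳ {P = _≤ d} (λ m le → ≤-trans (m⊓n≤n m _) le) ≤-refl

foldr-⊓-glb : ∀ {b d} {xs : List ℕ} → b ≤ d → All (b ≤_) xs → b ≤ foldr _⊓_ d xs
foldr-⊓-glb = foldr-preservesᵇ ⊓-glb

T-not : ∀ b → T (not b) ⇔ (¬ T b)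
T-not true  = mk⇔ (λ ()) (λ ¬tt → ¬tt tt)
T-not false = mk⇔ (λ _ ()) _

T-implies : ∀ a {b} → T (not a ∨ b) ⇔ (T a → T b)
T-implies true  = mk⇔ (λ b _ → b) (λ f → f tt)
T-implies false = mk⇔ (λ _ ()) _

T-nand₃ : ∀ a b c → T (not (a ∧ b ∧ c)) ⇔ (T a → T b → ¬ T c)
T-nand₃ true  true  true  = mk⇔ (λ ()) (λ f → f tt tt tt)
T-nand₃ true  true  false = mk⇔ (λ _ _ _ ()) _
T-nand₃ true  false _     = mk⇔ (λ _ _ ()) _
T-nand₃ false _     _     = mk⇔ (λ _ ()) _

T-implies₂ : ∀ a b {c} → T (not (a ∧ not b) ∨ c) ⇔ (T a → ¬ T b → T c)
T-implies₂ true  false = mk⇔ (λ c _ _ → c) (λ f → f tt (λ ()))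
T-implies₂ true  true  = mk⇔ (λ _ _ ¬b → ⊥-elim (¬b tt)) _
T-implies₂ false _     = mk⇔ (λ _ ()) _

allᵇ⇔ : {p : Fin n → Bool} → T (allᵇ p) ⇔ (∀ v → T (p v))
allᵇ⇔ {n} {p} = mk⇔
  (λ h v → All.lookup (all⁺ p (allFin n) h) (∈-allFin v))
  (λ h → all⁻ p {allFin n} (All.tabulate (λ {v} _ → h v)))

anyᵇ⇔ : {p : Fin n → Bool} → T (anyᵇ p) ⇔ ∃ (λ v → T (p v))
anyᵇ⇔ {n} {p} = mk⇔
  (λ h → satisfied (any⁻ p (allFin n) h))
  (λ (v , pv) → any⁺ p (lose (∈-allFin v) pv))

infix 4 _∈ˢ_ _⊆ˢ_

_∈ˢ_ : Fin n → VSet n → Set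
v ∈ˢ S = T (v ∈ᵇ S)

_⊆ˢ_ : VSet n → VSet n → Set
A ⊆ˢ B = ∀ {v} → v ∈ˢ A → v ∈ˢ B

Disjoint : VSet n → VSet n → Set
Disjoint A B = ∀ {v} → v ∈ˢ A → ¬ v ∈ˢ B

Independent : Graph n → VSet n → Set
Independent G J = ∀ {u v} → u ∈ˢ J → v ∈ˢ J → ¬ T (adj G u v)

Dominates : Graph n → VSet n → VSet n → Set
Dominates G J S = ∀ {v} → v ∈ˢ S → ¬ v ∈ˢ J → ∃ λ u → u ∈ˢ J × T (adj G u v)

record IndependentIn (G : Graph n) (S J : VSet n) : Set where
  constructor _,_
  field
    ⊆S          : J ⊆ˢ S
    independent : Independent G J

record MaximalIndependentIn (G : Graph n) (S J : VSet n) : Set where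
  constructor _,_
  field
    independentIn : IndependentIn G S J
    dominates     : Dominates G J S

open IndependentIn
open MaximalIndependentIn

∈-full : (v : Fin n) → v ∈ˢ full
∈-full v rewrite lookup∘tabulate (λ (_ : Fin _) → true) v = tt

∈-complement : (S : VSet n) (v : Fin n) → v ∈ˢ complement S ⇔ (¬ v ∈ˢ S)
∈-complement S v rewrite lookup∘tabulate (λ u → not (u ∈ᵇ S)) v = T-not (v ∈ᵇ S)

∈-∪ : (A B : VSet n) (v : Fin n) → v ∈ˢ A ∪ B ⇔ (v ∈ˢ A ⊎ v ∈ˢ B)
∈-∪ A B v rewrite lookup-zipWith _∨_ v A B = T-∨

∈-closedNbhd : (G : Graph n) (I : VSet n) (v : Fin n) →
  v ∈ˢ closedNbhd G I ⇔ (v ∈ˢ I ⊎ ∃ λ u → u ∈ˢ I × T (adj G u v))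
∈-closedNbhd G I v
  rewrite lookup∘tabulate (λ w → (w ∈ᵇ I) ∨ anyᵇ (λ u → (u ∈ᵇ I) ∧ adj G u w)) v =
  mk⇔ (Sum.map₂ (Product.map₂ (to T-∧) ∘ to anyᵇ⇔) ∘ to T-∨)
      (from T-∨ ∘ Sum.map₂ (from anyᵇ⇔ ∘ Product.map₂ (from T-∧)))

subsetᵇ⇔ : {A B : VSet n} → T (subsetᵇ A B) ⇔ A ⊆ˢ B
subsetᵇ⇔ {A = A} = mk⇔
  (λ h {v} → to (T-implies (v ∈ᵇ A)) (to allᵇ⇔ h v))
  (λ h → from allᵇ⇔ (λ v → from (T-implies (v ∈ᵇ A)) h))

independentᵇ⇔ : {G : Graph n} {J : VSet n} → T (independentᵇ G J) ⇔ Independent G J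
independentᵇ⇔ {G = G} {J} = mk⇔
  (λ h {u} {v} → to (T-nand₃ (u ∈ᵇ J) (v ∈ᵇ J) (adj G u v)) (to allᵇ⇔ (to allᵇ⇔ h u) v))
  (λ h → from allᵇ⇔ λ u → from allᵇ⇔ λ v → from (T-nand₃ (u ∈ᵇ J) (v ∈ᵇ J) (adj G u v)) h)

indepInᵇ⇔ : {G : Graph n} {S J : VSet n} → T (indepInᵇ G S J) ⇔ IndependentIn G S J
indepInᵇ⇔ {G = G} {S} {J} = mk⇔
  (λ h → let J⊆S , J-indep = to T-∧ h in
         to (subsetᵇ⇔ {A = J} {S}) J⊆S , to (independentᵇ⇔ {G = G} {J}) J-indep)
  (λ (J⊆S , J-indep) →
     from T-∧ (from (subsetᵇ⇔ {A = J} {S}) J⊆S , from (independentᵇ⇔ {G = G} {J}) J-indep))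

maximalIndepInᵇ⇔ : {G : Graph n} {S J : VSet n} →
  T (maximalIndepInᵇ G S J) ⇔ MaximalIndependentIn G S J
maximalIndepInᵇ⇔ {G = G} {S} {J} = mk⇔
  (λ h → let J-indepIn , J-dom = to T-∧ h in
         to (indepInᵇ⇔ {G = G}) J-indepIn , to dominates⇔ J-dom)
  (λ (J-indepIn , J-dom) →
     from T-∧ (from (indepInᵇ⇔ {G = G}) J-indepIn , from dominates⇔ J-dom))
  where
  dominates⇔ : T (allᵇ (λ v → not ((v ∈ᵇ S) ∧ not (v ∈ᵇ J)) ∨ anyᵇ (λ u → (u ∈ᵇ J) ∧ adj G u v)))
             ⇔ Dominates G J S
  dominates⇔ = mk⇔
    (λ h {v} v∈S v∉J →
       Product.map₂ (to T-∧) (to anyᵇ⇔ (to (T-implies₂ (v ∈ᵇ S) (v ∈ᵇ J)) (to allᵇ⇔ h v) v∈S v∉J)))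
    (λ h → from allᵇ⇔ λ v → from (T-implies₂ (v ∈ᵇ S) (v ∈ᵇ J))
       (λ v∈S v∉J → from anyᵇ⇔ (Product.map₂ (from T-∧) (h v∈S v∉J))))

∈-subsets : (J : VSet n) → J ∈ subsets n
∈-subsets []          = here refl
∈-subsets (true ∷ J)  = ∈-++⁺ˡ (∈-map⁺ (true ∷_) (∈-subsets J))
∈-subsets (false ∷ J) = ∈-++⁺ʳ (map (true ∷_) (subsets _)) (∈-map⁺ (false ∷_) (∈-subsets J))

sizesSatisfying : (VSet n → Bool) → List ℕ
sizesSatisfying {n} p = map size (filter (λ J → p J ≟ true) (subsets n))

∈-sizesSatisfying : (p : VSet n → Bool) (J : VSet n) → T (p J) → size J ∈ sizesSatisfying p
∈-sizesSatisfying p J pJ =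
  ∈-map⁺ size (∈-filter⁺ (λ K → p K ≟ true) (∈-subsets J) (to T-≡ pJ))

All-sizesSatisfying : {P : ℕ → Set} (p : VSet n → Bool) →
  (∀ {J} → T (p J) → P (size J)) → All P (sizesSatisfying p)
All-sizesSatisfying {n} p h =
  map⁺ (All.tabulate λ J∈ → h (from T-≡ (proj₂ (∈-filter⁻ (λ K → p K ≟ true) {xs = subsets n} J∈))))

module _ {G : Graph n} {S : VSet n} where

  size≤αIn : {J : VSet n} → IndependentIn G S J → size J ≤ αIn G S
  size≤αIn {J} J-indep =
    All.lookup (foldr-⊔-upperBounds (sizesSatisfying (indepInᵇ G S)))
    (∈-sizesSatisfying (indepInᵇ G S) J (from (indepInᵇ⇔ {G = G} {S} {J}) J-indep))

  αIn-lub : {b : ℕ} → (∀ {J} → IndependentIn G S J → size J ≤ b) → αIn G S ≤ b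
  αIn-lub h = foldr-⊔-lub (All-sizesSatisfying (indepInᵇ G S)
    (λ {J} → h {J} ∘ to (indepInᵇ⇔ {G = G} {S} {J})))

  iIn≤size : {K : VSet n} → MaximalIndependentIn G S K → iIn G S ≤ size K
  iIn≤size {K} K-max =
    All.lookup (foldr-⊓-lowerBounds n (sizesSatisfying (maximalIndepInᵇ G S)))
    (∈-sizesSatisfying (maximalIndepInᵇ G S) K (from (maximalIndepInᵇ⇔ {G = G} {S} {K}) K-max))

  iIn≤n : iIn G S ≤ n
  iIn≤n = foldr-⊓≤init n (sizesSatisfying (maximalIndepInᵇ G S))

  -- b ≤ n because the minimum in iIn is taken starting from n.
  iIn-glb : {b : ℕ} → b ≤ n → (∀ {K} → MaximalIndependentIn G S K → b ≤ size K) → b ≤ iIn G S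
  iIn-glb b≤n h = foldr-⊓-glb b≤n (All-sizesSatisfying (maximalIndepInᵇ G S)
    (λ {K} → h {K} ∘ to (maximalIndepInᵇ⇔ {G = G} {S} {K})))

size-∪ : (A B : VSet n) → Disjoint A B → size (A ∪ B) ≡ size A + size B
size-∪ []          []          _    = refl
size-∪ (true ∷ A)  (true ∷ B)  disj = ⊥-elim (disj {zero} tt tt)
size-∪ (true ∷ A)  (false ∷ B) disj = cong suc (size-∪ A B (λ {v} → disj {suc v}))
size-∪ (false ∷ A) (true ∷ B)  disj =
  ≡.trans (cong suc (size-∪ A B (λ {v} → disj {suc v}))) (≡.sym (+-suc (size A) (size B)))
size-∪ (false ∷ A) (false ∷ B) disj = size-∪ A B (λ {v} → disj {suc v})

module _ (G : Graph n) (I : VSet n) where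

  private
    S : VSet n
    S = complement (closedNbhd G I)

  ∈S⇒∉I : {v : Fin n} → v ∈ˢ S → ¬ v ∈ˢ I
  ∈S⇒∉I {v} v∈S v∈I =
    to (∈-complement (closedNbhd G I) v) v∈S (from (∈-closedNbhd G I v) (inj₁ v∈I))

  I-S-nonadjacent : {u v : Fin n} → u ∈ˢ I → v ∈ˢ S → ¬ T (adj G u v)
  I-S-nonadjacent {u} {v} u∈I v∈S uv =
    to (∈-complement (closedNbhd G I) v) v∈S (from (∈-closedNbhd G I v) (inj₂ (u , u∈I , uv)))

  ∪-independent : {J : VSet n} → Independent G I → IndependentIn G S J →
    IndependentIn G full (I ∪ J)
  ∪-independent {J} I-indep (J⊆S , J-indep) = (λ {v} _ → ∈-full v) , indep
    where
    indep : Independent G (I ∪ J)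
    indep {u} {v} u∈ v∈ with to (∈-∪ I J u) u∈ | to (∈-∪ I J v) v∈
    ... | inj₁ u∈I | inj₁ v∈I = I-indep u∈I v∈I
    ... | inj₁ u∈I | inj₂ v∈J = I-S-nonadjacent u∈I (J⊆S v∈J)
    ... | inj₂ u∈J | inj₁ v∈I = I-S-nonadjacent v∈I (J⊆S u∈J) ∘ subst T (Graph.sym G u v)
    ... | inj₂ u∈J | inj₂ v∈J = J-indep u∈J v∈J

  ∪-dominates : {K : VSet n} → Dominates G K S → Dominates G (I ∪ K) full
  ∪-dominates {K} K-dom {v} _ v∉I∪K with T? (v ∈ᵇ closedNbhd G I)
  ... | yes v∈N[I] with to (∈-closedNbhd G I v) v∈N[I]
  ...   | inj₁ v∈I             = ⊥-elim (v∉I∪K (from (∈-∪ I K v) (inj₁ v∈I)))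
  ...   | inj₂ (u , u∈I , uv) = u , from (∈-∪ I K u) (inj₁ u∈I) , uv
  ∪-dominates {K} K-dom {v} _ v∉I∪K | no v∉N[I] =
    let v∈S = from (∈-complement (closedNbhd G I) v) v∉N[I]
        u , u∈K , uv = K-dom v∈S (v∉I∪K ∘ from (∈-∪ I K v) ∘ inj₂)
    in  u , from (∈-∪ I K u) (inj₂ u∈K) , uv

  ∪-maximal : {K : VSet n} → Independent G I → MaximalIndependentIn G S K →
    MaximalIndependentIn G full (I ∪ K)
  ∪-maximal I-indep (K-indepIn , K-dom) = ∪-independent I-indep K-indepIn , ∪-dominates K-dom

  size-∪-⊆S : {J : VSet n} → J ⊆ˢ S → size (I ∪ J) ≡ size I + size J
  size-∪-⊆S {J} J⊆S = size-∪ I J (λ v∈I v∈J → ∈S⇒∉I (J⊆S v∈J) v∈I)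

  αIn-minusClosedNbhd : Independent G I → αIn G S ≤ αIn G full ∸ size I
  αIn-minusClosedNbhd I-indep = αIn-lub λ {J} J-indepIn → m+n≤o⇒m≤o∸n (size J) (begin
    size J + size I ≡⟨ +-comm (size J) (size I) ⟩
    size I + size J ≡⟨ ≡.sym (size-∪-⊆S (⊆S J-indepIn)) ⟩
    size (I ∪ J)    ≤⟨ size≤αIn (∪-independent I-indep J-indepIn) ⟩
    αIn G full      ∎)

  iIn-minusClosedNbhd : Independent G I → iIn G full ≤ size I + iIn G S
  iIn-minusClosedNbhd I-indep = begin
    iIn G full                     ≤⟨ m≤n+m∸n (iIn G full) (size I) ⟩
    size I + (iIn G full ∸ size I) ≤⟨ +-monoʳ-≤ (size I) (iIn-glb below-n bound) ⟩
    size I + iIn G S               ∎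
    where
    below-n : iIn G full ∸ size I ≤ n
    below-n = ≤-trans (m∸n≤m (iIn G full) (size I)) (iIn≤n {G = G} {full})

    bound : {K : VSet n} → MaximalIndependentIn G S K → iIn G full ∸ size I ≤ size K
    bound {K} K-max = m≤n+o⇒m∸n≤o (iIn G full) (size I) (begin
      iIn G full      ≤⟨ iIn≤size (∪-maximal I-indep K-max) ⟩
      size (I ∪ K)    ≡⟨ size-∪-⊆S (⊆S (independentIn K-max)) ⟩
      size I + size K ∎)

lemma2p4 : ∀ {n} (G : Graph n) (I : VSet n) → IsIndependent G I →
    μαMinusClosedNbhd G I ≤ μα G
lemma2p4 G I I-indepᵇ = begin
  αIn G S ∸ iIn G S                ≤⟨ ∸-monoˡ-≤ (iIn G S) (αIn-minusClosedNbhd G I I-indep) ⟩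
  αIn G full ∸ size I ∸ iIn G S    ≡⟨ ∸-+-assoc (αIn G full) (size I) (iIn G S) ⟩
  αIn G full ∸ (size I + iIn G S)  ≤⟨ ∸-monoʳ-≤ (αIn G full) (iIn-minusClosedNbhd G I I-indep) ⟩
  αIn G full ∸ iIn G full          ∎
  where
  S : VSet _
  S = complement (closedNbhd G I)

  I-indep : Independent G I
  I-indep = to (independentᵇ⇔ {G = G} {I}) (from T-≡ I-indepᵇ)
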